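{- Let $n\ge 2$ and $j\ge 0$. There is a bijection between the set of pairs $(b,\pi)$, where $b\in[n]$ and $\pi$ is a normal permutation of $[n-1]$ with exactly $j$ odd cycles, and the set of normal permutations of $[n]$ with exactly $j$ odd cycles that are not threshold permutations.
   Context: A signed permutation of $[m]$ is a permutation $\pi_1\cdots\pi_m$ of $[m]$ with a sign $w_i\in\{+,-\}$ assigned to each $\pi_i$. A normal permutation is a signed permutation such that for every $i\ge 2$ with $w_i=+$ we have $\pi_i>\pi_{i-1}$. A threshold permutation of size $m$ is a signed permutation of $[m]$ such that: (1) $\pi_1<\pi_2$; (2) if $\pi_1=1$ then $w_1=-$; (3) if $\pi_1\ne 1$ then $w_2=-$; (4) for every $i\ge 2$ with $w_i=+$ we have $\pi_i>\pi_{i-1}$. Compartments of a signed permutation: draw a line before $\pi_1$; then repeatedly draw a line immediately after the least entry located after the last line drawn, until a line is drawn after $\pi_m$; the segments between consecutive lines are the compartments. An odd cycle is a compartment containing an odd number of entries with sign $-$. -}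

module Defs where

open import Data.Nat using (ℕ; zero; suc; _≡ᵇ_; _<ᵇ_; _∸_)
open import Data.Nat.Properties using ()
open import Data.Bool using (Bool; true; false; _∧_; _∨_; not; T; if_then_else_)
open import Data.List using (List; []; _∷_; length; map; upTo)
open import Data.Product using (_×_; _,_; proj₁; proj₂; Σ)
open import Data.Fin using (Fin)

allB : {A : Set} → (A → Bool) → List A → Bool
allB p []       = true
allB p (x ∷ xs) = p x ∧ allB p xs

countB : {A : Set} → (A → Bool) → List A → ℕ
countB p []       = 0
countB p (x ∷ xs) = if p x then suc (countB p xs) else countB p xs

data Sign : Set where
  plus minus : Sign

isMinus : Sign → Bool
isMinus plus  = false
isMinus minus = true

-- A signed word: the list π₁ w₁ , … , π_m w_m  (entries as natural numbers).
SignedWord : Set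
SignedWord = List (ℕ × Sign)

countVal : ℕ → SignedWord → ℕ
countVal k []            = 0
countVal k ((x , _) ∷ l) = if x ≡ᵇ k then suc (countVal k l) else countVal k l

range1 : ℕ → List ℕ
range1 m = map suc (upTo m)

isSignedPerm : ℕ → SignedWord → Bool
isSignedPerm m l = (length l ≡ᵇ m) ∧ allB (λ k → countVal k l ≡ᵇ 1) (range1 m)

plusAscents : SignedWord → Bool
plusAscents []                            = true
plusAscents (_ ∷ [])                      = true
plusAscents ((x , _) ∷ (y , plus) ∷ l)    = (x <ᵇ y) ∧ plusAscents ((y , plus) ∷ l)
plusAscents ((x , _) ∷ (y , minus) ∷ l)   = plusAscents ((y , minus) ∷ l)

isNormal : ℕ → SignedWord → Bool
isNormal m l = isSignedPerm m l ∧ plusAscents l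

thresholdFirst : SignedWord → Bool
thresholdFirst ((x , w₁) ∷ (y , w₂) ∷ _) =
  (x <ᵇ y) ∧ (if x ≡ᵇ 1 then isMinus w₁ else isMinus w₂)
thresholdFirst _ = false

isThreshold : ℕ → SignedWord → Bool
isThreshold m l = isSignedPerm m l ∧ thresholdFirst l ∧ plusAscents l

-- minimum value among entries (0 for the empty word; only used on nonempty words)
minVal : SignedWord → ℕ
minVal []            = 0
minVal ((x , _) ∷ []) = x
minVal ((x , _) ∷ l@(_ ∷ _)) = let m = minVal l in if x <ᵇ m then x else m

splitAfter : ℕ → SignedWord → SignedWord × SignedWord
splitAfter k [] = [] , []
splitAfter k ((x , w) ∷ l) =
  if x ≡ᵇ k then ((x , w) ∷ [] , l)
  else (let r = splitAfter k l in ((x , w) ∷ proj₁ r , proj₂ r))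

-- compartments: repeatedly cut immediately after the least entry of the
-- remaining suffix.  Fuel = length suffices since each step removes ≥ 1 entry.
compartmentsFuel : ℕ → SignedWord → List SignedWord
compartmentsFuel zero    _  = []
compartmentsFuel (suc f) [] = []
compartmentsFuel (suc f) l@(_ ∷ _) =
  let r = splitAfter (minVal l) l in proj₁ r ∷ compartmentsFuel f (proj₂ r)

compartments : SignedWord → List SignedWord
compartments l = compartmentsFuel (length l) l

countMinus : SignedWord → ℕ
countMinus l = countB (λ e → isMinus (proj₂ e)) l

isOddNat : ℕ → Bool
isOddNat zero          = false
isOddNat (suc zero)    = true
isOddNat (suc (suc n)) = isOddNat n

oddCycles : SignedWord → ℕ
oddCycles l = countB (λ c → isOddNat (countMinus c)) (compartments l)

NormalOdd : ℕ → ℕ → Set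
NormalOdd m j = Σ SignedWord (λ l → T (isNormal m l ∧ (oddCycles l ≡ᵇ j)))

NormalOddNonThreshold : ℕ → ℕ → Set
NormalOddNonThreshold m j =
  Σ SignedWord (λ l → T (isNormal m l ∧ (oddCycles l ≡ᵇ j) ∧ not (isThreshold m l)))

-- Given b ∈ [n] and a normal π of [n − 1], shift the entries of π that are ≥ b up by one and
-- put b in front. Relabelling by an order embedding changes neither ascents nor compartments, so
-- only the new first entry matters. If b = 1 it is the least entry: it forms a compartment of its
-- own, gets the sign + (so the result is not threshold) and adds no odd cycle. If b ≥ 2 the entry 1
-- still comes later, so b joins the first compartment of π. Normality then forces the sign of the
-- old first entry c (− exactly when c < b), which is also what makes the result non-threshold, and
-- b takes the sign that keeps the parity of −'s in that compartment. Conversely, a non-threshold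
-- normal permutation starting with 1 has the sign + there, so deleting the first entry, folding
-- its sign into the second one and closing the gap inverts the construction.

module Submission where

open import Defs
open import Data.Bool using (Bool; true; false; _∧_; _∨_; not; T; if_then_else_)
open import Data.Bool.Properties
  using (T-≡; T-∧; T-not-≡; T-irrelevant; not-involutive; ∧-identityʳ; ∧-zeroʳ; ∧-conicalˡ; ∧-conicalʳ)
open import Data.Empty using (⊥-elim)
open import Data.Fin using (Fin; toℕ; fromℕ<)
open import Data.Fin.Properties using (toℕ<n; toℕ-fromℕ<; fromℕ<-toℕ)
open import Data.List using (List; []; _∷_; length; map)
open import Data.List.Properties using (length-map; map-∘; map-id-local; ∷-injective)
open import Data.List.Relation.Unary.All as All using (All; []; _∷_; universal)
open import Data.List.Relation.Unary.All.Properties using (map⁺; map⁻; applyUpTo⁺₁; applyUpTo⁻)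
open import Data.Nat using (ℕ; zero; suc; _+_; _∸_; _≤_; _<_; _≡ᵇ_; _<ᵇ_; z≤n; s≤s)
open import Data.Nat.Properties
  using ( ≡ᵇ⇒≡; ≡⇒≡ᵇ; <ᵇ⇒<; <⇒<ᵇ; ≤-refl; ≤-reflexive; ≤-trans; ≤-<-trans; <-trans; <-irrefl; <-asym
        ; <⇒≤; <⇒≢; ≮⇒≥; ≤∧≢⇒<; n≤1+n; n<1+n; m≤n⇒m≤1+n; 1+n≰n; suc-injective; +-suc )
open import Data.Product using (Σ; _×_; _,_; proj₁; proj₂; map₁; map₂)
open import Data.Product.Properties using (×-≡,≡→≡)
open import Data.Unit using (⊤; tt)
open import Function using (_∘_; id; case_of_)
open import Function.Bundles using (_↔_; mk↔ₛ′; Equivalence)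
open import Relation.Binary.PropositionalEquality
open import Relation.Nullary using (¬_)

_·_ : Sign → Sign → Sign
plus  · w     = w
minus · plus  = minus
minus · minus = plus

·-identityʳ : ∀ s → s · plus ≡ s
·-identityʳ plus  = refl
·-identityʳ minus = refl

·-inverse : ∀ s → s · s ≡ plus
·-inverse plus  = refl
·-inverse minus = refl

s·[s·w]≡w : ∀ s w → s · (s · w) ≡ w
s·[s·w]≡w plus  w     = refl
s·[s·w]≡w minus plus  = refl
s·[s·w]≡w minus minus = refl

minusIf : Bool → Sign
minusIf true  = minus
minusIf false = plus

≡ᵇ-refl : ∀ x → (x ≡ᵇ x) ≡ true
≡ᵇ-refl x = Equivalence.to T-≡ (≡⇒≡ᵇ x x refl)

≡ᵇ-sym : ∀ x y → (x ≡ᵇ y) ≡ (y ≡ᵇ x)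
≡ᵇ-sym zero    zero    = refl
≡ᵇ-sym zero    (suc y) = refl
≡ᵇ-sym (suc x) zero    = refl
≡ᵇ-sym (suc x) (suc y) = ≡ᵇ-sym x y

≡ᵇ-true⇒≡ : ∀ {x y} → (x ≡ᵇ y) ≡ true → x ≡ y
≡ᵇ-true⇒≡ {x} {y} e = ≡ᵇ⇒≡ x y (Equivalence.from T-≡ e)

≡ᵇ≡false⇒≢ : ∀ {m n} → (m ≡ᵇ n) ≡ false → m ≢ n
≡ᵇ≡false⇒≢ {m} m≢n refl with () ← trans (sym (≡ᵇ-refl m)) m≢n

<ᵇ≡true⇒< : ∀ {m n} → (m <ᵇ n) ≡ true → m < n
<ᵇ≡true⇒< {m} {n} e = <ᵇ⇒< m n (Equivalence.from T-≡ e)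

<⇒<ᵇ≡true : ∀ {m n} → m < n → (m <ᵇ n) ≡ true
<⇒<ᵇ≡true m<n = Equivalence.to T-≡ (<⇒<ᵇ m<n)

<ᵇ≡false⇒≥ : ∀ {m n} → (m <ᵇ n) ≡ false → n ≤ m
<ᵇ≡false⇒≥ e = ≮⇒≥ λ m<n → subst T e (<⇒<ᵇ m<n)

≮⇒<ᵇ≡false : ∀ {m n} → ¬ m < n → (m <ᵇ n) ≡ false
≮⇒<ᵇ≡false {m} {n} m≮n with m <ᵇ n in eq
... | true  = ⊥-elim (m≮n (<ᵇ≡true⇒< eq))
... | false = refl

≢⇒≡ᵇ≡false : ∀ {m n} → m ≢ n → (m ≡ᵇ n) ≡ false
≢⇒≡ᵇ≡false {m} {n} m≢n with m ≡ᵇ n in eq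
... | true  = ⊥-elim (m≢n (≡ᵇ-true⇒≡ eq))
... | false = refl

-- punchIn b x = x for x < b and x + 1 otherwise; punchOut b undoes it away from b.
punchIn : ℕ → ℕ → ℕ
punchIn zero    x       = suc x
punchIn (suc b) zero    = zero
punchIn (suc b) (suc x) = suc (punchIn b x)

punchOut : ℕ → ℕ → ℕ
punchOut zero    zero    = zero
punchOut zero    (suc x) = x
punchOut (suc b) zero    = zero
punchOut (suc b) (suc x) = suc (punchOut b x)

punchIn-≡ᵇ : ∀ b x y → (punchIn b x ≡ᵇ punchIn b y) ≡ (x ≡ᵇ y)
punchIn-≡ᵇ zero    x       y       = refl
punchIn-≡ᵇ (suc b) zero    zero    = refl
punchIn-≡ᵇ (suc b) zero    (suc y) = refl
punchIn-≡ᵇ (suc b) (suc x) zero    = refl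
punchIn-≡ᵇ (suc b) (suc x) (suc y) = punchIn-≡ᵇ b x y

punchIn-<ᵇ : ∀ b x y → (punchIn b x <ᵇ punchIn b y) ≡ (x <ᵇ y)
punchIn-<ᵇ zero    x       y       = refl
punchIn-<ᵇ (suc b) zero    zero    = refl
punchIn-<ᵇ (suc b) zero    (suc y) = refl
punchIn-<ᵇ (suc b) (suc x) zero    = refl
punchIn-<ᵇ (suc b) (suc x) (suc y) = punchIn-<ᵇ b x y

punchIn-≢ : ∀ b x → (punchIn b x ≡ᵇ b) ≡ false
punchIn-≢ zero    x       = refl
punchIn-≢ (suc b) zero    = refl
punchIn-≢ (suc b) (suc x) = punchIn-≢ b x

<ᵇ-punchIn : ∀ b x → (b <ᵇ punchIn b x) ≡ not (x <ᵇ b)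
<ᵇ-punchIn zero    x       = refl
<ᵇ-punchIn (suc b) zero    = refl
<ᵇ-punchIn (suc b) (suc x) = <ᵇ-punchIn b x

punchIn-≤ : ∀ b x → punchIn b x ≤ suc x
punchIn-≤ zero    x       = ≤-refl
punchIn-≤ (suc b) zero    = z≤n
punchIn-≤ (suc b) (suc x) = s≤s (punchIn-≤ b x)

punchOut-punchIn : ∀ b x → punchOut b (punchIn b x) ≡ x
punchOut-punchIn zero    x       = refl
punchOut-punchIn (suc b) zero    = refl
punchOut-punchIn (suc b) (suc x) = cong suc (punchOut-punchIn b x)

punchIn-punchOut : ∀ {b x} → (x ≡ᵇ b) ≡ false → punchIn b (punchOut b x) ≡ x
punchIn-punchOut {zero}  {suc x} _ = refl
punchIn-punchOut {suc b} {zero}  _ = refl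
punchIn-punchOut {suc b} {suc x} x≢b = cong suc (punchIn-punchOut x≢b)

punchOut-< : ∀ {b x m} → (x ≡ᵇ b) ≡ false → x ≤ m → b ≤ m → punchOut b x < m
punchOut-< {zero}  {suc x} _ x≤m _ = x≤m
punchOut-< {suc b} {zero}  {suc m} _ _ _ = s≤s z≤n
punchOut-< {suc b} {suc x} {suc m} x≢b (s≤s x≤m) (s≤s b≤m) = s≤s (punchOut-< x≢b x≤m b≤m)

punchOut-≡ᵇ : ∀ {b x} k → (x ≡ᵇ b) ≡ false → (punchOut b x ≡ᵇ k) ≡ (x ≡ᵇ punchIn b k)
punchOut-≡ᵇ {b} {x} k x≢b = begin
  (punchOut b x ≡ᵇ k)                     ≡⟨ sym (punchIn-≡ᵇ b (punchOut b x) k) ⟩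
  (punchIn b (punchOut b x) ≡ᵇ punchIn b k) ≡⟨ cong (_≡ᵇ punchIn b k) (punchIn-punchOut {b} {x} x≢b) ⟩
  (x ≡ᵇ punchIn b k)                      ∎
  where open ≡-Reasoning

punchIn-≡ᵇ-punchOut : ∀ {b k} x → (k ≡ᵇ b) ≡ false → (punchIn b x ≡ᵇ k) ≡ (x ≡ᵇ punchOut b k)
punchIn-≡ᵇ-punchOut {b} {k} x k≢b = begin
  (punchIn b x ≡ᵇ k)                      ≡⟨ cong (punchIn b x ≡ᵇ_) (sym (punchIn-punchOut {b} {k} k≢b)) ⟩
  (punchIn b x ≡ᵇ punchIn b (punchOut b k)) ≡⟨ punchIn-≡ᵇ b x (punchOut b k) ⟩
  (x ≡ᵇ punchOut b k)                     ∎
  where open ≡-Reasoning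

<-punchIn : ∀ {b x} → b ≤ x → b < punchIn b x
<-punchIn {zero}          _         = s≤s z≤n
<-punchIn {suc b} {suc x} (s≤s b≤x) = s≤s (<-punchIn b≤x)

punchOut-<ᵇ : ∀ {b y} → (y ≡ᵇ b) ≡ false → (punchOut b y <ᵇ b) ≡ not (b <ᵇ y)
punchOut-<ᵇ {b} {y} y≢b = begin
  (punchOut b y <ᵇ b)                       ≡⟨ sym (not-involutive _) ⟩
  not (not (punchOut b y <ᵇ b))             ≡⟨ cong not (sym (<ᵇ-punchIn b (punchOut b y))) ⟩
  not (b <ᵇ punchIn b (punchOut b y))       ≡⟨ cong (λ z → not (b <ᵇ z)) (punchIn-punchOut {b} {y} y≢b) ⟩
  not (b <ᵇ y)                              ∎
  where open ≡-Reasoning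

-- Relabelling by order embeddings

relabel : (ℕ → ℕ) → SignedWord → SignedWord
relabel f = map (map₁ f)

Values : (ℕ → Set) → SignedWord → Set
Values P = All (P ∘ proj₁)

Avoids : ℕ → ℕ → Set
Avoids b x = (x ≡ᵇ b) ≡ false

record OrderEmbeddingOn (P : ℕ → Set) (f : ℕ → ℕ) : Set where
  field
    preserves-≡ᵇ : ∀ {x y} → P x → P y → (f x ≡ᵇ f y) ≡ (x ≡ᵇ y)
    preserves-<ᵇ : ∀ {x y} → P x → P y → (f x <ᵇ f y) ≡ (x <ᵇ y)

open OrderEmbeddingOn

punchIn-orderEmbedding : ∀ b → OrderEmbeddingOn (λ _ → ⊤) (punchIn b)
punchIn-orderEmbedding b = record
  { preserves-≡ᵇ = λ {x} {y} _ _ → punchIn-≡ᵇ b x y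
  ; preserves-<ᵇ = λ {x} {y} _ _ → punchIn-<ᵇ b x y
  }

punchOut-orderEmbedding : ∀ b → OrderEmbeddingOn (Avoids b) (punchOut b)
punchOut-orderEmbedding b = record
  { preserves-≡ᵇ = λ {x} {y} x≢b y≢b → trans (sym (punchIn-≡ᵇ b (punchOut b x) (punchOut b y)))
                     (cong₂ _≡ᵇ_ (punchIn-punchOut {b} x≢b) (punchIn-punchOut {b} y≢b))
  ; preserves-<ᵇ = λ {x} {y} x≢b y≢b → trans (sym (punchIn-<ᵇ b (punchOut b x) (punchOut b y)))
                     (cong₂ _<ᵇ_ (punchIn-punchOut {b} x≢b) (punchIn-punchOut {b} y≢b))
  }

relabel-inverse : ∀ {f g} l → Values (λ x → g (f x) ≡ x) l → relabel g (relabel f l) ≡ l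
relabel-inverse l gf≡id =
  trans (sym (map-∘ l)) (map-id-local (All.map (λ {e} gfx≡x → cong (_, proj₂ e) gfx≡x) gf≡id))

Values-sign : ∀ {P y s r} t → Values P ((y , s) ∷ r) → Values P ((y , t) ∷ r)
Values-sign t (py ∷ ps) = py ∷ ps

countVal-relabel : ∀ {P f k k′} l → (∀ {x} → P x → (f x ≡ᵇ k) ≡ (x ≡ᵇ k′)) →
  Values P l → countVal k (relabel f l) ≡ countVal k′ l
countVal-relabel []            f-hits []        = refl
countVal-relabel {k′ = k′} ((x , w) ∷ l) f-hits (px ∷ ps) rewrite f-hits px with x ≡ᵇ k′
... | true  = cong suc (countVal-relabel l f-hits ps)
... | false = countVal-relabel l f-hits ps

countVal-absent : ∀ {k} l → Values (Avoids k) l → countVal k l ≡ 0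
countVal-absent []            []          = refl
countVal-absent ((x , w) ∷ l) (x≢k ∷ ps) rewrite x≢k = countVal-absent l ps

countVal≡0⇒avoids : ∀ k l → countVal k l ≡ 0 → Values (Avoids k) l
countVal≡0⇒avoids k []            _ = []
countVal≡0⇒avoids k ((x , w) ∷ l) c with x ≡ᵇ k in x≢k
... | false = x≢k ∷ countVal≡0⇒avoids k l c

countMinus-relabel : ∀ f l → countMinus (relabel f l) ≡ countMinus l
countMinus-relabel f []                = refl
countMinus-relabel f ((x , plus)  ∷ l) = countMinus-relabel f l
countMinus-relabel f ((x , minus) ∷ l) = cong suc (countMinus-relabel f l)

plusAscents-relabel : ∀ {P f} → OrderEmbeddingOn P f → ∀ l → Values P l →
  plusAscents (relabel f l) ≡ plusAscents l
plusAscents-relabel e [] _ = refl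
plusAscents-relabel e (_ ∷ []) _ = refl
plusAscents-relabel e ((x , _) ∷ (y , plus) ∷ l) (px ∷ py ∷ ps) =
  cong₂ _∧_ (preserves-<ᵇ e px py) (plusAscents-relabel e ((y , plus) ∷ l) (py ∷ ps))
plusAscents-relabel e ((x , _) ∷ (y , minus) ∷ l) (px ∷ py ∷ ps) =
  plusAscents-relabel e ((y , minus) ∷ l) (py ∷ ps)

plusAscents-sign : ∀ x s t l → plusAscents ((x , s) ∷ l) ≡ plusAscents ((x , t) ∷ l)
plusAscents-sign x s t []              = refl
plusAscents-sign x s t ((y , plus) ∷ l)  = refl
plusAscents-sign x s t ((y , minus) ∷ l) = refl

plusAscents-∷ : ∀ {x v y s} l → (s ≡ plus → (x <ᵇ y) ≡ true) →
  plusAscents ((y , s) ∷ l) ≡ true → plusAscents ((x , v) ∷ (y , s) ∷ l) ≡ true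
plusAscents-∷ {s = plus}  l x<y asc = cong₂ _∧_ (x<y refl) asc
plusAscents-∷ {s = minus} l _   asc = asc

plusAscents-tail : ∀ x v l → plusAscents ((x , v) ∷ l) ≡ true → plusAscents l ≡ true
plusAscents-tail x v []              asc = refl
plusAscents-tail x v ((y , plus) ∷ l)  asc = ∧-conicalʳ _ _ asc
plusAscents-tail x v ((y , minus) ∷ l) asc = asc

minVal-value : ∀ {P} x w l → Values P ((x , w) ∷ l) → P (minVal ((x , w) ∷ l))
minVal-value x w []            (px ∷ _)  = px
minVal-value x w ((y , v) ∷ l) (px ∷ ps) with x <ᵇ minVal ((y , v) ∷ l)
... | true  = px
... | false = minVal-value y v l ps

minVal-relabel : ∀ {P f} → OrderEmbeddingOn P f → ∀ x w l → Values P ((x , w) ∷ l) →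
  minVal (relabel f ((x , w) ∷ l)) ≡ f (minVal ((x , w) ∷ l))
minVal-relabel e x w []            _ = refl
minVal-relabel e x w ((y , v) ∷ l) (px ∷ ps)
  rewrite minVal-relabel e y v l ps | preserves-<ᵇ e px (minVal-value y v l ps)
  with x <ᵇ minVal ((y , v) ∷ l)
... | true  = refl
... | false = refl

splitAfter-relabel : ∀ {P f} → OrderEmbeddingOn P f → ∀ {k} l → P k → Values P l →
  splitAfter (f k) (relabel f l) ≡ (relabel f (proj₁ (splitAfter k l)) , relabel f (proj₂ (splitAfter k l)))
splitAfter-relabel e []            pk _ = refl
splitAfter-relabel e {k} ((x , w) ∷ l) pk (px ∷ ps) rewrite preserves-≡ᵇ e px pk with x ≡ᵇ k
... | true  = refl
... | false rewrite splitAfter-relabel e l pk ps = refl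

Values-splitAfter₂ : ∀ {P} k l → Values P l → Values P (proj₂ (splitAfter k l))
Values-splitAfter₂ k []            _         = []
Values-splitAfter₂ k ((x , w) ∷ l) (px ∷ ps) with x ≡ᵇ k
... | true  = ps
... | false = Values-splitAfter₂ k l ps

compartmentsFuel-relabel : ∀ {P f} → OrderEmbeddingOn P f → ∀ F l → Values P l →
  compartmentsFuel F (relabel f l) ≡ map (relabel f) (compartmentsFuel F l)
compartmentsFuel-relabel e zero    l             _  = refl
compartmentsFuel-relabel e (suc F) []            _  = refl
compartmentsFuel-relabel {f = f} e (suc F) l@((x , w) ∷ l′) ps
  rewrite minVal-relabel e x w l′ ps | splitAfter-relabel e l (minVal-value x w l′ ps) ps =
  cong (relabel f (proj₁ (splitAfter μ l)) ∷_)
       (compartmentsFuel-relabel e F (proj₂ (splitAfter μ l)) (Values-splitAfter₂ μ l ps))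
  where μ = minVal l

countB-map : ∀ {A B : Set} (p : B → Bool) (g : A → B) xs → countB p (map g xs) ≡ countB (p ∘ g) xs
countB-map p g []       = refl
countB-map p g (x ∷ xs) with p (g x)
... | true  = cong suc (countB-map p g xs)
... | false = countB-map p g xs

countB-cong : ∀ {A : Set} {p q : A → Bool} → (∀ x → p x ≡ q x) → ∀ xs → countB p xs ≡ countB q xs
countB-cong p≗q []       = refl
countB-cong {q = q} p≗q (x ∷ xs) rewrite p≗q x with q x
... | true  = cong suc (countB-cong p≗q xs)
... | false = countB-cong p≗q xs

isOddCompartment : SignedWord → Bool
isOddCompartment c = isOddNat (countMinus c)

oddCycles-relabel : ∀ {P f} → OrderEmbeddingOn P f → ∀ l → Values P l → oddCycles (relabel f l) ≡ oddCycles l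
oddCycles-relabel {f = f} e l ps = begin
  countB isOddCompartment (compartmentsFuel (length (relabel f l)) (relabel f l))
    ≡⟨ cong (λ F → countB isOddCompartment (compartmentsFuel F (relabel f l))) (length-map (map₁ f) l) ⟩
  countB isOddCompartment (compartmentsFuel (length l) (relabel f l))
    ≡⟨ cong (countB isOddCompartment) (compartmentsFuel-relabel e (length l) l ps) ⟩
  countB isOddCompartment (map (relabel f) (compartments l))
    ≡⟨ countB-map isOddCompartment (relabel f) (compartments l) ⟩
  countB (isOddCompartment ∘ relabel f) (compartments l)
    ≡⟨ countB-cong (λ c → cong isOddNat (countMinus-relabel f c)) (compartments l) ⟩
  oddCycles l ∎
  where open ≡-Reasoning

-- Compartments

splitAtMin : SignedWord → SignedWord × SignedWord
splitAtMin l = splitAfter (minVal l) l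

length-splitAfter₂ : ∀ k l → length (proj₂ (splitAfter k l)) ≤ length l
length-splitAfter₂ k []            = z≤n
length-splitAfter₂ k ((x , w) ∷ l) with x ≡ᵇ k
... | true  = n≤1+n _
... | false = ≤-trans (length-splitAfter₂ k l) (n≤1+n _)

length-splitAfter₂-∷ : ∀ k e l → length (proj₂ (splitAfter k (e ∷ l))) ≤ length l
length-splitAfter₂-∷ k (x , w) l with x ≡ᵇ k
... | true  = ≤-refl
... | false = length-splitAfter₂ k l

compartmentsFuel-irrelevant : ∀ F G l → length l ≤ F → length l ≤ G →
  compartmentsFuel F l ≡ compartmentsFuel G l
compartmentsFuel-irrelevant zero    zero    []      _ _ = refl
compartmentsFuel-irrelevant zero    (suc G) []      _ _ = refl
compartmentsFuel-irrelevant (suc F) zero    []      _ _ = refl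
compartmentsFuel-irrelevant (suc F) (suc G) []      _ _ = refl
compartmentsFuel-irrelevant (suc F) (suc G) (e ∷ l) (s≤s l≤F) (s≤s l≤G) =
  cong (proj₁ (splitAtMin (e ∷ l)) ∷_)
       (compartmentsFuel-irrelevant F G _ (≤-trans rest≤l l≤F) (≤-trans rest≤l l≤G))
  where rest≤l = length-splitAfter₂-∷ (minVal (e ∷ l)) e l

compartments-∷ : ∀ e l →
  compartments (e ∷ l) ≡ proj₁ (splitAtMin (e ∷ l)) ∷ compartments (proj₂ (splitAtMin (e ∷ l)))
compartments-∷ e l = cong (proj₁ (splitAtMin (e ∷ l)) ∷_)
  (compartmentsFuel-irrelevant (length l) _ _ (length-splitAfter₂-∷ (minVal (e ∷ l)) e l) ≤-refl)

minVal-sign : ∀ y s t r → minVal ((y , s) ∷ r) ≡ minVal ((y , t) ∷ r)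
minVal-sign y s t []      = refl
minVal-sign y s t (_ ∷ _) = refl

minVal-≤-head : ∀ x w l → minVal ((x , w) ∷ l) ≤ x
minVal-≤-head x w []      = ≤-refl
minVal-≤-head x w (e ∷ l) with x <ᵇ minVal (e ∷ l) in x<μ
... | true  = ≤-refl
... | false = <ᵇ≡false⇒≥ x<μ

minVal-≤-tail : ∀ x w e l → minVal ((x , w) ∷ e ∷ l) ≤ minVal (e ∷ l)
minVal-≤-tail x w e l with x <ᵇ minVal (e ∷ l) in x<μ
... | true  = <⇒≤ (<ᵇ≡true⇒< x<μ)
... | false = ≤-refl

minVal-≤ : ∀ {k c} x w l → countVal k ((x , w) ∷ l) ≡ suc c → minVal ((x , w) ∷ l) ≤ k
minVal-≤ {k} x w l k∈l with x ≡ᵇ k in x≡k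
minVal-≤ x w l             _   | true  = ≤-trans (minVal-≤-head x w l) (≤-reflexive (≡ᵇ-true⇒≡ x≡k))
minVal-≤ x w ((y , v) ∷ l) k∈l | false = ≤-trans (minVal-≤-tail x w (y , v) l) (minVal-≤ y v l k∈l)

splitAfter-∷ : ∀ k y s r →
  splitAfter k ((y , s) ∷ r) ≡ map₁ ((y , s) ∷_) (if y ≡ᵇ k then ([] , r) else splitAfter k r)
splitAfter-∷ k y s r with y ≡ᵇ k
... | true  = refl
... | false = refl

compartments-∷-sign : ∀ y r → Σ (SignedWord × List SignedWord) λ (A , cs) →
  ∀ s → compartments ((y , s) ∷ r) ≡ ((y , s) ∷ A) ∷ cs
compartments-∷-sign y r = (proj₁ rest , compartments (proj₂ rest)) , λ s → begin
  compartments ((y , s) ∷ r)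
    ≡⟨ compartments-∷ (y , s) r ⟩
  proj₁ (splitAtMin ((y , s) ∷ r)) ∷ compartments (proj₂ (splitAtMin ((y , s) ∷ r)))
    ≡⟨ cong (λ p → proj₁ p ∷ compartments (proj₂ p))
            (trans (cong (λ k → splitAfter k ((y , s) ∷ r)) (minVal-sign y s plus r)) (splitAfter-∷ μ y s r)) ⟩
  ((y , s) ∷ proj₁ rest) ∷ compartments (proj₂ rest) ∎
  where
  open ≡-Reasoning
  μ = minVal ((y , plus) ∷ r)
  rest = if y ≡ᵇ μ then ([] , r) else splitAfter μ r

minVal-∷-least : ∀ x w l → Values (x <_) l → minVal ((x , w) ∷ l) ≡ x
minVal-∷-least x w []            _ = refl
minVal-∷-least x w ((y , v) ∷ l) x<l rewrite <⇒<ᵇ≡true (minVal-value y v l x<l) = refl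

compartments-∷-least : ∀ x w l → Values (x <_) l → compartments ((x , w) ∷ l) ≡ ((x , w) ∷ []) ∷ compartments l
compartments-∷-least x w l x<l =
  trans (compartments-∷ (x , w) l) (cong (λ p → proj₁ p ∷ compartments (proj₂ p)) split-at-x)
  where
  split-at-x : splitAfter (minVal ((x , w) ∷ l)) ((x , w) ∷ l) ≡ ((x , w) ∷ [] , l)
  split-at-x rewrite minVal-∷-least x w l x<l | ≡ᵇ-refl x = refl

splitAtMin-∷-above : ∀ x w e l → minVal (e ∷ l) < x →
  splitAtMin ((x , w) ∷ e ∷ l) ≡ map₁ ((x , w) ∷_) (splitAtMin (e ∷ l))
splitAtMin-∷-above x w e l μ<x
  rewrite ≮⇒<ᵇ≡false (<-asym μ<x) | ≢⇒≡ᵇ≡false (≢-sym (<⇒≢ μ<x)) = refl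

compartments-∷-above : ∀ x w l {c cs} → minVal l < x → compartments l ≡ c ∷ cs →
  compartments ((x , w) ∷ l) ≡ ((x , w) ∷ c) ∷ cs
compartments-∷-above x w (e ∷ l) μ<x comps = begin
  compartments ((x , w) ∷ e ∷ l)
    ≡⟨ compartments-∷ (x , w) (e ∷ l) ⟩
  proj₁ (splitAtMin ((x , w) ∷ e ∷ l)) ∷ compartments (proj₂ (splitAtMin ((x , w) ∷ e ∷ l)))
    ≡⟨ cong (λ p → proj₁ p ∷ compartments (proj₂ p)) (splitAtMin-∷-above x w e l μ<x) ⟩
  ((x , w) ∷ proj₁ (splitAtMin (e ∷ l))) ∷ compartments (proj₂ (splitAtMin (e ∷ l)))
    ≡⟨ cong₂ (λ c cs → ((x , w) ∷ c) ∷ cs) (proj₁ split-comps) (proj₂ split-comps) ⟩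
  _ ∎
  where
  open ≡-Reasoning
  split-comps = ∷-injective (trans (sym (compartments-∷ e l)) comps)

oddCycles-∷-least : ∀ x l → Values (x <_) l → oddCycles ((x , plus) ∷ l) ≡ oddCycles l
oddCycles-∷-least x l x<l = cong (countB isOddCompartment) (compartments-∷-least x plus l x<l)

isOddCompartment-merge : ∀ x y s t A →
  isOddCompartment ((x , s · t) ∷ (y , s) ∷ A) ≡ isOddCompartment ((y , t) ∷ A)
isOddCompartment-merge x y plus  t     A = refl
isOddCompartment-merge x y minus plus  A = refl
isOddCompartment-merge x y minus minus A = refl

oddCycles-merge : ∀ x y s t r → minVal ((y , s) ∷ r) < x →
  oddCycles ((x , s · t) ∷ (y , s) ∷ r) ≡ oddCycles ((y , t) ∷ r)
oddCycles-merge x y s t r μ<x with compartments-∷-sign y r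
... | (A , cs) , comps = begin
  countB isOddCompartment (compartments ((x , s · t) ∷ (y , s) ∷ r))
    ≡⟨ cong (countB isOddCompartment) (compartments-∷-above x (s · t) ((y , s) ∷ r) μ<x (comps s)) ⟩
  countB isOddCompartment (((x , s · t) ∷ (y , s) ∷ A) ∷ cs)
    ≡⟨ cong (λ b → if b then suc (countB isOddCompartment cs) else countB isOddCompartment cs)
            (isOddCompartment-merge x y s t A) ⟩
  countB isOddCompartment (((y , t) ∷ A) ∷ cs)
    ≡⟨ cong (countB isOddCompartment) (sym (comps t)) ⟩
  countB isOddCompartment (compartments ((y , t) ∷ r)) ∎
  where open ≡-Reasoning

Permutes : ℕ → SignedWord → Set
Permutes m l = length l ≡ m × (∀ {i} → i < m → countVal (suc i) l ≡ 1)

InRange : ℕ → ℕ → Set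
InRange m x = 1 ≤ x × x ≤ m

T-allB⇒All : ∀ {A : Set} (p : A → Bool) xs → T (allB p xs) → All (T ∘ p) xs
T-allB⇒All p []       _ = []
T-allB⇒All p (x ∷ xs) t with Equivalence.to T-∧ t
... | px , pxs = px ∷ T-allB⇒All p xs pxs

All⇒T-allB : ∀ {A : Set} {p : A → Bool} {xs} → All (T ∘ p) xs → T (allB p xs)
All⇒T-allB []         = _
All⇒T-allB (px ∷ pxs) = Equivalence.from T-∧ (px , All⇒T-allB pxs)

isSignedPerm⇒Permutes : ∀ m l → T (isSignedPerm m l) → Permutes m l
isSignedPerm⇒Permutes m l t with Equivalence.to T-∧ t
... | len , counts = ≡ᵇ⇒≡ _ m len , λ i<m →
  ≡ᵇ⇒≡ _ 1 (applyUpTo⁻ id m (map⁻ (T-allB⇒All _ (range1 m) counts)) i<m)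

Permutes⇒isSignedPerm : ∀ m l → Permutes m l → T (isSignedPerm m l)
Permutes⇒isSignedPerm m l (len , counts) = Equivalence.from T-∧
  (≡⇒≡ᵇ _ m len , All⇒T-allB (map⁺ (applyUpTo⁺₁ id m λ i<m → ≡⇒≡ᵇ _ 1 (counts i<m))))

inRange : ℕ → ℕ → Bool
inRange zero    x = false
inRange (suc m) x = (x ≡ᵇ suc m) ∨ inRange m x

inRange-above : ∀ {m x} → m < x → inRange m x ≡ false
inRange-above {zero}      m<x = refl
inRange-above {suc m} {x} m<x
  rewrite ≢⇒≡ᵇ≡false (λ x≡m → <-irrefl (sym x≡m) m<x) | inRange-above {m} {x} (<-trans (n<1+n m) m<x) = refl

inRange-bounds : ∀ {m x} → inRange m x ≡ true → InRange m x
inRange-bounds {suc m} {x} x∈ with x ≡ᵇ suc m in x≡m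
... | true  = subst (InRange (suc m)) (sym (≡ᵇ-true⇒≡ x≡m)) (s≤s z≤n , ≤-refl)
... | false = map₂ m≤n⇒m≤1+n (inRange-bounds x∈)

countB-∨ : ∀ {A : Set} (p q : A → Bool) → (∀ {x} → p x ≡ true → q x ≡ false) →
  ∀ xs → countB (λ x → p x ∨ q x) xs ≡ countB p xs + countB q xs
countB-∨ p q disjoint [] = refl
countB-∨ p q disjoint (x ∷ xs) with p x in px
... | true rewrite disjoint px = cong suc (countB-∨ p q disjoint xs)
... | false with q x
...   | true  = trans (cong suc (countB-∨ p q disjoint xs)) (sym (+-suc (countB p xs) (countB q xs)))
...   | false = countB-∨ p q disjoint xs

countB-false : ∀ {A : Set} (xs : List A) → countB (λ _ → false) xs ≡ 0
countB-false []       = refl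
countB-false (x ∷ xs) = countB-false xs

countB-≤-length : ∀ {A : Set} (p : A → Bool) xs → countB p xs ≤ length xs
countB-≤-length p []       = z≤n
countB-≤-length p (x ∷ xs) with p x
... | true  = s≤s (countB-≤-length p xs)
... | false = m≤n⇒m≤1+n (countB-≤-length p xs)

countB≡length⇒All : ∀ {A : Set} (p : A → Bool) xs → countB p xs ≡ length xs → All (λ x → p x ≡ true) xs
countB≡length⇒All p []       _ = []
countB≡length⇒All p (x ∷ xs) c with p x in px
... | true  = px ∷ countB≡length⇒All p xs (suc-injective c)
... | false = ⊥-elim (1+n≰n (≤-trans (≤-reflexive (sym c)) (countB-≤-length p xs)))

countVal-countB : ∀ k l → countVal k l ≡ countB (λ e → proj₁ e ≡ᵇ k) l
countVal-countB k []            = refl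
countVal-countB k ((x , w) ∷ l) with x ≡ᵇ k
... | true  = cong suc (countVal-countB k l)
... | false = countVal-countB k l

countB-inRange : ∀ {m} l → Permutes m l → ∀ {i} → i ≤ m → countB (inRange i ∘ proj₁) l ≡ i
countB-inRange l p {zero} _ = countB-false l
countB-inRange l p@(_ , counts) {suc i} i<m = begin
  countB (λ e → (proj₁ e ≡ᵇ suc i) ∨ inRange i (proj₁ e)) l
    ≡⟨ countB-∨ (λ e → proj₁ e ≡ᵇ suc i) (inRange i ∘ proj₁) (λ {e} → disjoint {e}) l ⟩
  countB (λ e → proj₁ e ≡ᵇ suc i) l + countB (inRange i ∘ proj₁) l
    ≡⟨ cong₂ _+_ (trans (sym (countVal-countB (suc i) l)) (counts i<m)) (countB-inRange l p (<⇒≤ i<m)) ⟩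
  suc i ∎
  where
  open ≡-Reasoning
  disjoint : ∀ {e : ℕ × Sign} → (proj₁ e ≡ᵇ suc i) ≡ true → inRange i (proj₁ e) ≡ false
  disjoint {e} x≡i = inRange-above {i} {proj₁ e} (≤-reflexive (sym (≡ᵇ-true⇒≡ x≡i)))

Permutes⇒InRange : ∀ {m} l → Permutes m l → Values (InRange m) l
Permutes⇒InRange {m} l p@(len , _) =
  All.map inRange-bounds
    (countB≡length⇒All (inRange m ∘ proj₁) l (trans (countB-inRange l p ≤-refl) (sym len)))

countVal-∷-self : ∀ x w l → countVal x ((x , w) ∷ l) ≡ suc (countVal x l)
countVal-∷-self x w l rewrite ≡ᵇ-refl x = refl

countVal-∷-other : ∀ {k x} w l → (x ≡ᵇ k) ≡ false → countVal k ((x , w) ∷ l) ≡ countVal k l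
countVal-∷-other w l x≢k rewrite x≢k = refl

Permutes-∷-punchIn : ∀ {m b} w l → 1 ≤ b → b ≤ suc m → Permutes m l →
  Permutes (suc m) ((b , w) ∷ relabel (punchIn b) l)
Permutes-∷-punchIn {m} {suc b} w l _ (s≤s b≤m) (len , counts) = cong suc (trans (length-map _ l) len) , count
  where
  count : ∀ {i} → i < suc m → countVal (suc i) ((suc b , w) ∷ relabel (punchIn (suc b)) l) ≡ 1
  count {i} (s≤s i≤m) with b ≡ᵇ i in b≡i
  ... | true  = cong suc (subst (λ k → countVal k (relabel (punchIn (suc b)) l) ≡ 0) (cong suc (≡ᵇ-true⇒≡ b≡i))
                  (countVal-absent _ (map⁺ (universal (λ e → punchIn-≢ (suc b) (proj₁ e)) l))))
  ... | false = trans (countVal-relabel {P = λ _ → ⊤} l (λ {x} _ → punchIn-≡ᵇ-punchOut {suc b} {suc i} x i≢b)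
                                        (universal (λ _ → tt) l))
                  (counts (punchOut-< {b} {i} i≢b i≤m b≤m))
    where
    i≢b : (i ≡ᵇ b) ≡ false
    i≢b = trans (≡ᵇ-sym i b) b≡i

Permutes-∷⇒avoids : ∀ {m b} w l → Permutes m ((b , w) ∷ l) → Values (Avoids b) l
Permutes-∷⇒avoids {b = b} w l p with All.head (Permutes⇒InRange ((b , w) ∷ l) p)
Permutes-∷⇒avoids {b = suc b} w l p@(_ , counts) | s≤s z≤n , b<m =
  countVal≡0⇒avoids (suc b) l (suc-injective (trans (sym (countVal-∷-self (suc b) w l)) (counts b<m)))

Permutes-punchOut : ∀ {m b} w l → Permutes (suc m) ((b , w) ∷ l) → Permutes m (relabel (punchOut b) l)
Permutes-punchOut {b = b} w l p with All.head (Permutes⇒InRange ((b , w) ∷ l) p)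
Permutes-punchOut {b = suc b} w l p@(len , counts) | s≤s z≤n , _ =
  trans (length-map _ l) (suc-injective len) , λ {i} i<m → begin
    countVal (suc i) (relabel (punchOut (suc b)) l)
      ≡⟨ countVal-relabel l (λ {x} x≢b → punchOut-≡ᵇ {suc b} {x} (suc i) x≢b) (Permutes-∷⇒avoids w l p) ⟩
    countVal (suc (punchIn b i)) l
      ≡⟨ sym (countVal-∷-other {suc (punchIn b i)} {suc b} w l
                (trans (≡ᵇ-sym b (punchIn b i)) (punchIn-≢ b i))) ⟩
    countVal (suc (punchIn b i)) ((suc b , w) ∷ l)
      ≡⟨ counts (≤-<-trans (punchIn-≤ b i) (s≤s i<m)) ⟩
    1 ∎
  where open ≡-Reasoning

Permutes-1∷⇒>1 : ∀ {m} w l → Permutes m ((1 , w) ∷ l) → Values (1 <_) l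
Permutes-1∷⇒>1 w l p = All.zipWith
  (λ ((1≤x , _) , x≢1) → ≤∧≢⇒< 1≤x (≢-sym (≡ᵇ≡false⇒≢ x≢1)))
  (All.tail (Permutes⇒InRange ((1 , w) ∷ l) p) , Permutes-∷⇒avoids w l p)

record IsNormalOdd (m j : ℕ) (l : SignedWord) : Set where
  field
    permutes     : Permutes m l
    plusAscents≡ : plusAscents l ≡ true
    oddCycles≡   : oddCycles l ≡ j

open IsNormalOdd

NonThreshold : ℕ → ℕ → SignedWord → Set
NonThreshold m j l = IsNormalOdd m j l × thresholdFirst l ≡ false

fromT-normalOdd : ∀ {m j} l → T (isNormal m l ∧ (oddCycles l ≡ᵇ j)) → IsNormalOdd m j l
fromT-normalOdd {m} {j} l t with Equivalence.to T-∧ t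
... | normal , odd with Equivalence.to (T-∧ {isSignedPerm m l}) normal
...   | perm , asc = record
  { permutes     = isSignedPerm⇒Permutes m l perm
  ; plusAscents≡ = Equivalence.to T-≡ asc
  ; oddCycles≡   = ≡ᵇ⇒≡ (oddCycles l) j odd
  }

toT-normal : ∀ {m j l} → IsNormalOdd m j l → T (isNormal m l)
toT-normal {m} {l = l} n =
  Equivalence.from T-∧ (Permutes⇒isSignedPerm m l (permutes n) , Equivalence.from T-≡ (plusAscents≡ n))

toT-normalOdd : ∀ {m j l} → IsNormalOdd m j l → T (isNormal m l ∧ (oddCycles l ≡ᵇ j))
toT-normalOdd {j = j} {l} n = Equivalence.from T-∧ (toT-normal n , ≡⇒≡ᵇ (oddCycles l) j (oddCycles≡ n))

isThreshold-normal : ∀ m l → T (isNormal m l) → isThreshold m l ≡ thresholdFirst l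
isThreshold-normal m l t with Equivalence.to (T-∧ {isSignedPerm m l}) t
... | perm , asc rewrite Equivalence.to T-≡ perm | Equivalence.to T-≡ asc = ∧-identityʳ (thresholdFirst l)

fromT-nonThreshold : ∀ {m j} l → T (isNormal m l ∧ (oddCycles l ≡ᵇ j) ∧ not (isThreshold m l)) →
  NonThreshold m j l
fromT-nonThreshold {m} l t with Equivalence.to T-∧ t
... | normal , odd∧nt with Equivalence.to T-∧ odd∧nt
...   | odd , nt =
  fromT-normalOdd l (Equivalence.from T-∧ (normal , odd)) ,
  trans (sym (isThreshold-normal m l normal)) (Equivalence.to T-not-≡ nt)

toT-nonThreshold : ∀ {m j l} → NonThreshold m j l →
  T (isNormal m l ∧ (oddCycles l ≡ᵇ j) ∧ not (isThreshold m l))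
toT-nonThreshold {m} {j} {l} (n , tf) = Equivalence.from T-∧ (toT-normal n , Equivalence.from T-∧
  (≡⇒≡ᵇ (oddCycles l) j (oddCycles≡ n) ,
   Equivalence.from T-not-≡ (trans (isThreshold-normal m l (toT-normal n)) tf)))

-- Putting a value in front

secondSign : ℕ → ℕ → Sign → Sign
secondSign (suc zero) c w = w
secondSign b          c w = minusIf (c <ᵇ b)

prependValue : ℕ → SignedWord → SignedWord
prependValue b []            = (b , plus) ∷ []
prependValue b ((c , w) ∷ r) =
  (b , secondSign b c w · w) ∷ relabel (punchIn b) ((c , secondSign b c w) ∷ r)

removeFirst : SignedWord → SignedWord
removeFirst ((b , w) ∷ (y , s) ∷ r) = relabel (punchOut b) ((y , s · w) ∷ r)
removeFirst _                       = []

firstValue : SignedWord → ℕ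
firstValue []            = 0
firstValue ((v , _) ∷ _) = v

secondSign≡plus⇒≮ : ∀ {b c} w → 1 ≤ c → secondSign b c w ≡ plus → (c <ᵇ b) ≡ false
secondSign≡plus⇒≮ {zero}                w _ _ = refl
secondSign≡plus⇒≮ {suc zero}    {suc c} w _ _ = refl
secondSign≡plus⇒≮ {suc (suc b)} {c}     w _ s≡plus with c <ᵇ suc (suc b)
secondSign≡plus⇒≮ {suc (suc b)} {c}     w _ ()     | true
secondSign≡plus⇒≮ {suc (suc b)} {c}     w _ _      | false = refl

not∧isMinus-minusIf : ∀ x → not x ∧ isMinus (minusIf x) ≡ false
not∧isMinus-minusIf true  = refl
not∧isMinus-minusIf false = refl

prependValue-thresholdFirst : ∀ {b} c w r → 1 ≤ b → thresholdFirst (prependValue b ((c , w) ∷ r)) ≡ false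
prependValue-thresholdFirst {suc zero} c w r _ rewrite ·-inverse w = ∧-zeroʳ _
prependValue-thresholdFirst {suc (suc b)} c w r _
  rewrite <ᵇ-punchIn (suc (suc b)) c = not∧isMinus-minusIf (c <ᵇ suc (suc b))

prependValue-plusAscents : ∀ {b} c w r → 1 ≤ c → plusAscents ((c , w) ∷ r) ≡ true →
  plusAscents (prependValue b ((c , w) ∷ r)) ≡ true
prependValue-plusAscents {b} c w r 1≤c asc = plusAscents-∷ (relabel (punchIn b) r)
  (λ s≡plus → trans (<ᵇ-punchIn b c) (cong not (secondSign≡plus⇒≮ {b} {c} w 1≤c s≡plus)))
  (trans (plusAscents-relabel (punchIn-orderEmbedding b) ((c , s) ∷ r) (universal _ _))
         (trans (plusAscents-sign c s w r) asc))
  where s = secondSign b c w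

prependValue-oddCycles : ∀ {m b} c w r → 1 ≤ b → Values (1 ≤_) ((c , w) ∷ r) →
  Permutes (suc m) (prependValue b ((c , w) ∷ r)) →
  oddCycles (prependValue b ((c , w) ∷ r)) ≡ oddCycles ((c , w) ∷ r)
prependValue-oddCycles {b = suc zero} c w r _ 1≤π _ rewrite ·-inverse w = begin
  oddCycles ((1 , plus) ∷ relabel (punchIn 1) ((c , w) ∷ r))
    ≡⟨ oddCycles-∷-least 1 _ (map⁺ (All.map <-punchIn 1≤π)) ⟩
  oddCycles (relabel (punchIn 1) ((c , w) ∷ r))
    ≡⟨ oddCycles-relabel (punchIn-orderEmbedding 1) ((c , w) ∷ r) (universal _ _) ⟩
  oddCycles ((c , w) ∷ r) ∎
  where open ≡-Reasoning
prependValue-oddCycles {b = b@(suc (suc _))} c w r _ _ (_ , counts) = begin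
  oddCycles ((b , s · w) ∷ (punchIn b c , s) ∷ relabel (punchIn b) r)
    ≡⟨ oddCycles-merge b (punchIn b c) s w _ μ<b ⟩
  oddCycles (relabel (punchIn b) ((c , w) ∷ r))
    ≡⟨ oddCycles-relabel (punchIn-orderEmbedding b) ((c , w) ∷ r) (universal _ _) ⟩
  oddCycles ((c , w) ∷ r) ∎
  where
  open ≡-Reasoning
  s = secondSign b c w
  μ<b = ≤-<-trans (minVal-≤ (punchIn b c) s (relabel (punchIn b) r) (counts (s≤s z≤n))) (s≤s (s≤s z≤n))

prependValue-nonThreshold : ∀ {m j b} π → 1 ≤ b → b ≤ suc (suc m) →
  IsNormalOdd (suc m) j π → NonThreshold (suc (suc m)) j (prependValue b π)
prependValue-nonThreshold [] _ _ n = case proj₁ (permutes n) of λ ()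
prependValue-nonThreshold {b = b} π@((c , w) ∷ r) 1≤b b≤m n =
  record
    { permutes     = perm
    ; plusAscents≡ = prependValue-plusAscents {b} c w r (proj₁ (All.head 1≤π)) (plusAscents≡ n)
    ; oddCycles≡   = trans (prependValue-oddCycles c w r 1≤b (All.map proj₁ 1≤π) perm) (oddCycles≡ n)
    } ,
  prependValue-thresholdFirst c w r 1≤b
  where
  1≤π = Permutes⇒InRange π (permutes n)
  perm = Permutes-∷-punchIn (secondSign b c w · w) ((c , secondSign b c w) ∷ r) 1≤b b≤m (permutes n)

isMinus≡false⇒plus : ∀ {w} → isMinus w ≡ false → w ≡ plus
isMinus≡false⇒plus {plus} _ = refl

nonThreshold-1∷⇒plus : ∀ {m j} w y s r → NonThreshold m j ((1 , w) ∷ (y , s) ∷ r) → w ≡ plus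
nonThreshold-1∷⇒plus w y s r (n , tf) = isMinus≡false⇒plus (trans (cong (_∧ isMinus w) (sym 1<y)) tf)
  where 1<y = <⇒<ᵇ≡true (All.head (Permutes-1∷⇒>1 w ((y , s) ∷ r) (permutes n)))

secondSign-removeFirst : ∀ {m j b} w y s r → NonThreshold (suc m) j ((b , w) ∷ (y , s) ∷ r) →
  secondSign b (punchOut b y) (s · w) ≡ s
secondSign-removeFirst {b = zero} w y s r (n , _) =
  case proj₁ (All.head (Permutes⇒InRange ((zero , w) ∷ (y , s) ∷ r) (permutes n))) of λ ()
secondSign-removeFirst {b = suc zero} w y s r nt rewrite nonThreshold-1∷⇒plus w y s r nt = ·-identityʳ s
secondSign-removeFirst {b = b@(suc (suc _))} w y plus r (n , _)
  rewrite punchOut-<ᵇ {b} {y} (All.head (Permutes-∷⇒avoids w ((y , plus) ∷ r) (permutes n)))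
        | ∧-conicalˡ (b <ᵇ y) _ (plusAscents≡ n) = refl
secondSign-removeFirst {b = b@(suc (suc _))} w y minus r (n , tf)
  rewrite punchOut-<ᵇ {b} {y} (All.head (Permutes-∷⇒avoids w ((y , minus) ∷ r) (permutes n)))
        | trans (sym (∧-identityʳ (b <ᵇ y))) tf = refl

oddCycles-transferFirstSign : ∀ {m j b} w y s r → NonThreshold (suc m) j ((b , w) ∷ (y , s) ∷ r) →
  oddCycles ((b , w) ∷ (y , s) ∷ r) ≡ oddCycles ((y , s · w) ∷ r)
oddCycles-transferFirstSign {b = zero} w y s r (n , _) =
  case proj₁ (All.head (Permutes⇒InRange ((zero , w) ∷ (y , s) ∷ r) (permutes n))) of λ ()
oddCycles-transferFirstSign {b = suc zero} w y s r nt@(n , _)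
  rewrite nonThreshold-1∷⇒plus w y s r nt | ·-identityʳ s =
  oddCycles-∷-least 1 ((y , s) ∷ r) (Permutes-1∷⇒>1 plus ((y , s) ∷ r) (permutes n))
oddCycles-transferFirstSign {b = b@(suc (suc _))} w y s r (n , _) = begin
  oddCycles ((b , w) ∷ (y , s) ∷ r)
    ≡⟨ cong (λ t → oddCycles ((b , t) ∷ (y , s) ∷ r)) (sym (s·[s·w]≡w s w)) ⟩
  oddCycles ((b , s · (s · w)) ∷ (y , s) ∷ r)
    ≡⟨ oddCycles-merge b y s (s · w) r μ<b ⟩
  oddCycles ((y , s · w) ∷ r) ∎
  where
  open ≡-Reasoning
  μ<b = ≤-<-trans (minVal-≤ y s r (proj₂ (permutes n) (s≤s z≤n))) (s≤s (s≤s z≤n))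

removeFirst-normalOdd : ∀ {m j} σ → NonThreshold (suc (suc m)) j σ → IsNormalOdd (suc m) j (removeFirst σ)
removeFirst-normalOdd []                       (n , _) = case proj₁ (permutes n) of λ ()
removeFirst-normalOdd (_ ∷ [])                 (n , _) = case proj₁ (permutes n) of λ ()
removeFirst-normalOdd {j = j} ((b , w) ∷ (y , s) ∷ r) nt@(n , _) = record
  { permutes     = Permutes-punchOut {b = b} w ((y , s) ∷ r) (permutes n)
  ; plusAscents≡ = begin
      plusAscents (relabel (punchOut b) ((y , s · w) ∷ r))
        ≡⟨ plusAscents-relabel (punchOut-orderEmbedding b) ((y , s · w) ∷ r) (Values-sign (s · w) avoids) ⟩
      plusAscents ((y , s · w) ∷ r)
        ≡⟨ plusAscents-sign y (s · w) s r ⟩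
      plusAscents ((y , s) ∷ r)
        ≡⟨ plusAscents-tail b w ((y , s) ∷ r) (plusAscents≡ n) ⟩
      true ∎
  ; oddCycles≡   = begin
      oddCycles (relabel (punchOut b) ((y , s · w) ∷ r))
        ≡⟨ oddCycles-relabel (punchOut-orderEmbedding b) ((y , s · w) ∷ r) (Values-sign (s · w) avoids) ⟩
      oddCycles ((y , s · w) ∷ r)
        ≡⟨ sym (oddCycles-transferFirstSign w y s r nt) ⟩
      oddCycles ((b , w) ∷ (y , s) ∷ r)
        ≡⟨ oddCycles≡ n ⟩
      j ∎
  }
  where
  open ≡-Reasoning
  avoids = Permutes-∷⇒avoids w ((y , s) ∷ r) (permutes n)

removeFirst-prependValue : ∀ b π → removeFirst (prependValue b π) ≡ π
removeFirst-prependValue b []            = refl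
removeFirst-prependValue b ((c , w) ∷ r) =
  cong₂ _∷_ (cong₂ _,_ (punchOut-punchIn b c) (s·[s·w]≡w (secondSign b c w) w))
            (relabel-inverse r (universal (λ e → punchOut-punchIn b (proj₁ e)) r))

prependValue-removeFirst : ∀ {m j} σ → NonThreshold (suc (suc m)) j σ →
  prependValue (firstValue σ) (removeFirst σ) ≡ σ
prependValue-removeFirst []                       (n , _) = case proj₁ (permutes n) of λ ()
prependValue-removeFirst (_ ∷ [])                 (n , _) = case proj₁ (permutes n) of λ ()
prependValue-removeFirst ((b , w) ∷ (y , s) ∷ r) nt@(n , _) = begin
  (b , s′ · (s · w)) ∷ relabel (punchIn b) ((punchOut b y , s′) ∷ relabel (punchOut b) r)
    ≡⟨ cong (λ t → (b , t · (s · w)) ∷ relabel (punchIn b) ((punchOut b y , t) ∷ relabel (punchOut b) r))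
            (secondSign-removeFirst w y s r nt) ⟩
  (b , s · (s · w)) ∷ relabel (punchIn b) (relabel (punchOut b) ((y , s) ∷ r))
    ≡⟨ cong₂ (λ t l → (b , t) ∷ l) (s·[s·w]≡w s w)
             (relabel-inverse ((y , s) ∷ r) (All.map (punchIn-punchOut {b}) avoids)) ⟩
  (b , w) ∷ (y , s) ∷ r ∎
  where
  open ≡-Reasoning
  s′ = secondSign b (punchOut b y) (s · w)
  avoids = Permutes-∷⇒avoids w ((y , s) ∷ r) (permutes n)

firstValue-prependValue : ∀ b π → firstValue (prependValue b π) ≡ b
firstValue-prependValue b []      = refl
firstValue-prependValue b (_ ∷ _) = refl

toFin : ∀ {n v} → InRange n v → Fin n
toFin {v = suc v} (_ , v<n) = fromℕ< v<n

suc-toℕ-toFin : ∀ {n v} (r : InRange n v) → suc (toℕ (toFin r)) ≡ v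
suc-toℕ-toFin {v = suc v} (_ , v<n) = cong suc (toℕ-fromℕ< v<n)

toFin-suc-toℕ : ∀ {n v} (r : InRange n v) (i : Fin n) → v ≡ suc (toℕ i) → toFin r ≡ i
toFin-suc-toℕ (_ , i<n) i refl = fromℕ<-toℕ i i<n

firstValue-inRange : ∀ {m} σ → Permutes (suc m) σ → InRange (suc m) (firstValue σ)
firstValue-inRange []      (() , _)
firstValue-inRange (e ∷ l) p = All.head (Permutes⇒InRange (e ∷ l) p)

subset-≡ : ∀ {P : SignedWord → Set} → (∀ {l} (p q : P l) → p ≡ q) →
  ∀ {l l′} {p : P l} {q : P l′} → l ≡ l′ → _≡_ {A = Σ SignedWord P} (l , p) (l′ , q)
subset-≡ irr {p = p} {q} refl = cong (_ ,_) (irr p q)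

module _ {m j : ℕ} where

  prependFirst : Fin (suc (suc m)) × NormalOdd (suc m) j → NormalOddNonThreshold (suc (suc m)) j
  prependFirst (i , π , t) =
    prependValue (suc (toℕ i)) π ,
    toT-nonThreshold (prependValue-nonThreshold π (s≤s z≤n) (toℕ<n i) (fromT-normalOdd π t))

  splitFirst : NormalOddNonThreshold (suc (suc m)) j → Fin (suc (suc m)) × NormalOdd (suc m) j
  splitFirst (σ , t) =
    toFin (firstValue-inRange σ (permutes (proj₁ nt))) ,
    removeFirst σ , toT-normalOdd (removeFirst-normalOdd σ nt)
    where nt = fromT-nonThreshold σ t

  prependFirst-splitFirst : ∀ σ → prependFirst (splitFirst σ) ≡ σ
  prependFirst-splitFirst (σ , t) = subset-≡ T-irrelevant (begin
    prependValue (suc (toℕ (toFin r))) (removeFirst σ)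
      ≡⟨ cong (λ v → prependValue v (removeFirst σ)) (suc-toℕ-toFin r) ⟩
    prependValue (firstValue σ) (removeFirst σ)
      ≡⟨ prependValue-removeFirst σ nt ⟩
    σ ∎)
    where
    open ≡-Reasoning
    nt = fromT-nonThreshold σ t
    r = firstValue-inRange σ (permutes (proj₁ nt))

  splitFirst-prependFirst : ∀ x → splitFirst (prependFirst x) ≡ x
  splitFirst-prependFirst (i , π , t) = ×-≡,≡→≡
    ( toFin-suc-toℕ _ i (firstValue-prependValue (suc (toℕ i)) π)
    , subset-≡ T-irrelevant (removeFirst-prependValue (suc (toℕ i)) π))

lemma4p17 : (n j : ℕ) → 2 ≤ n →
    (Fin n × NormalOdd (n ∸ 1) j) ↔ NormalOddNonThreshold n j
lemma4p17 (suc (suc m)) j (s≤s (s≤s z≤n)) =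
  mk↔ₛ′ prependFirst splitFirst prependFirst-splitFirst splitFirst-prependFirst
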